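{- For every integer $n\ge 0$, the number of increasing trees $T\in\mathcal{T}_n$ with $\mathsf{ee}^*(T)=0$ equals the $n$-th Euler number $E_n$.
   Context: The Euler numbers are defined by $\sec(x)+\tan(x)=\sum_{n\ge0}E_n\frac{x^n}{n!}$. $\mathcal{T}_n$ is the set of increasing trees on $\{1,\dots,n\}$: plane trees (rooted trees with linearly ordered children) with $n+1$ nodes labeled bijectively by $0,1,\dots,n$ such that labels increase along every root-to-leaf path and the labels of the children of each node increase from left to right. The degree of a node is its number of children; its level is its distance from the root (root at level $0$). $\mathsf{ee}^*(T)$ is the number of nodes other than the root that have even degree and lie on an even level. -}

module Defs where

open import Data.Nat using (ℕ; zero; suc; _<_; _∸_)
import Data.Nat
open import Data.Nat.Combinatorics using (_C_)
open import Data.Integer as ℤ using (ℤ; +_; -_; _+_; _-_; _*_)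
open import Data.List using (List; []; _∷_; map; length; upTo; zipWith; foldr; _++_; [_])
open import Data.List.Relation.Unary.All using (All)
open import Data.Product using (_×_)
open import Data.Unit using (⊤)

-- Euler numbers, from  sec x + tan x = Σ E_n x^n / n!
-- Writing f = sec + tan we have f · cos = 1 + sin as formal power
-- series; comparing coefficients of x^n/n! (EGF product) gives
--   Σ_{k ≤ n} C(n,k) E_k cos_{n-k} = [n = 0] + sin_n
-- where cos_m, sin_m are the EGF coefficients of cos and sin.
-- Since cos_0 = 1 this determines E_n from E_0 … E_{n-1}.

cosc : ℕ → ℤ
cosc zero = + 1
cosc (suc zero) = + 0
cosc (suc (suc m)) = - cosc m

sinc : ℕ → ℤ
sinc zero = + 0
sinc (suc zero) = + 1
sinc (suc (suc m)) = - sinc m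

δ0 : ℕ → ℤ
δ0 zero = + 1
δ0 (suc _) = + 0

sumℤ : List ℤ → ℤ
sumℤ = foldr _+_ (+ 0)

next : ℕ → List ℤ → ℤ
next n es = δ0 n + sinc n - sumℤ (zipWith (λ k e → + (n C k) * e * cosc (n ∸ k)) (upTo n) es)

eulers : ℕ → List ℤ
eulers zero = []
eulers (suc n) = eulers n ++ [ next n (eulers n) ]

euler : ℕ → ℤ
euler n = next n (eulers n)

data LTree : Set where
  node : ℕ → List LTree → LTree

label : LTree → ℕ
label (node l _) = l

mutual
  labels : LTree → List ℕ
  labels (node l ts) = l ∷ labelsF ts

  labelsF : List LTree → List ℕ
  labelsF [] = []
  labelsF (t ∷ ts) = labels t ++ labelsF ts

Ascending : List ℕ → Set
Ascending [] = ⊤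
Ascending (x ∷ []) = ⊤
Ascending (x ∷ y ∷ xs) = x < y × Ascending (y ∷ xs)

mutual
  Increasing : LTree → Set
  Increasing (node l ts) =
    All (λ t → l < label t) ts × Ascending (map label ts) × IncreasingF ts

  IncreasingF : List LTree → Set
  IncreasingF [] = ⊤
  IncreasingF (t ∷ ts) = Increasing t × IncreasingF ts

-- T is an increasing tree on {1,…,n}: n+1 nodes labelled bijectively
-- by 0,1,…,n (as a multiset of labels, labels T is a permutation of
-- [0,…,n]) and increasing.
open import Data.List.Relation.Binary.Permutation.Propositional using (_↭_)

IsIncTree : ℕ → LTree → Set
IsIncTree n T = Increasing T × (labels T ↭ upTo (suc n))

-- ee*(T): number of non-root nodes of even degree on an even level.

open import Data.Bool using (Bool; true; false; _∧_; if_then_else_)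

isEven : ℕ → Bool
isEven zero = true
isEven (suc zero) = false
isEven (suc (suc m)) = isEven m

mutual
  eeAt : ℕ → LTree → ℕ
  eeAt d (node _ ts) =
    (if isEven d ∧ isEven (length ts) then 1 else 0) Data.Nat.+ eeAtF (suc d) ts

  eeAtF : ℕ → List LTree → ℕ
  eeAtF d [] = 0
  eeAtF d (t ∷ ts) = eeAt d t Data.Nat.+ eeAtF d ts

eeStar : LTree → ℕ
eeStar (node _ ts) = eeAtF 1 ts

{-# OPTIONS --safe #-}
module Submission where

-- Deleting the root of T leaves a forest whose roots lie on level 1, and
-- ee*(T) = 0 says that every node of it on an even level has odd degree.  Split
-- a forest at its least label x: the children of x form a forest one level
-- deeper, the other trees a forest on the same level.  Tracking the parity
-- of the level and of the number of trees, the exponential generating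
-- functions A, B of forests on odd levels with an even, resp. odd, number
-- of trees satisfy A′ = A B and B′ = A² with A(0) = 1 and B(0) = 0 (forests
-- on even levels are again counted by A).  Hence A = sec and B = tan, and
-- the trees are counted by A + B = sec + tan.

open import Defs
open import Algebra.Properties.CommutativeSemigroup using (interchange)
open import Data.Bool using (Bool; true; false; not; _∧_)
open import Data.Empty using (⊥; ⊥-elim)
open import Data.Integer using (ℤ; +_; -_; _+_; _-_; _*_)
import Data.Integer.Properties as ℤ
open import Data.Integer.Tactic.RingSolver using (solve-∀)
open import Data.List
  using (List; []; _∷_; _++_; [_]; map; applyUpTo; upTo; zipWith; length; concatMap; cartesianProductWith)
import Data.List.Properties as List
open import Data.List.Membership.Propositional using (_∈_; find; lose)
open import Data.List.Membership.Propositional.Properties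
  using (∈-++⁺ˡ; ∈-++⁺ʳ; ∈-++⁻; ∈-∃++; ∈-map⁺; ∈-map⁻; ∈-concatMap⁺; ∈-concatMap⁻;
         ∈-cartesianProductWith⁺; ∈-cartesianProductWith⁻)
open import Data.List.Relation.Binary.Permutation.Propositional
  using (_↭_; prep; ↭-refl; ↭-sym; ↭-trans)
open import Data.List.Relation.Binary.Permutation.Propositional.Properties
  using (↭-empty-inv; drop-∷; shift; ++⁺; ++⁺ˡ; ++⁺ʳ; ∈-resp-↭; All-resp-↭; ↭-length)
open import Data.List.Relation.Unary.All as All using (All; []; _∷_)
import Data.List.Relation.Unary.All.Properties as All
open import Data.List.Relation.Unary.AllPairs as AllPairs using (AllPairs; []; _∷_)
import Data.List.Relation.Unary.AllPairs.Properties as AllPairs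
open import Data.List.Relation.Unary.Any using (here; there)
open import Data.List.Relation.Unary.Unique.Propositional using (Unique)
import Data.List.Relation.Unary.Unique.Propositional.Properties as Unique
open import Data.Nat using (ℕ; zero; suc; _≤_; _<_; _∸_; z≤n; s≤s)
import Data.Nat as ℕ
open import Data.Nat.Combinatorics using (_C_; nCn≡1; nCk+nC[k+1]≡[n+1]C[k+1]; k>n⇒nCk≡0)
open import Data.Nat.Induction using (<-rec)
import Data.Nat.Properties as ℕₚ
open import Data.Product using (Σ; _×_; _,_; proj₁; proj₂; ∃)
import Data.Product as Product
open import Data.Sum using (inj₁; inj₂)
open import Data.Unit using (⊤; tt)
open import Function using (_∘_; id; case_of_)
open import Function.Bundles using (_⇔_; mk⇔; Equivalence)
import Function.Properties.Equivalence as ⇔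
open import Relation.Binary.PropositionalEquality hiding ([_])

strong-induction : (P : ℕ → Set) → P 0 → (∀ n → (∀ {k} → k ≤ n → P k) → P (suc n)) → ∀ n → P n
strong-induction P P₀ Pₛ = <-rec P λ where
  zero _ → P₀
  (suc n) ih → Pₛ n (ih ∘ s≤s)

-- Binomial convolution

∂ : {A : Set} → (ℕ → A) → ℕ → A
∂ f k = f (suc k)

infixl 7 _⋆_
infixl 6 _⊕_ _⊖_
infix 4 _≗[_]_

_⊕_ _⊖_ : (ℕ → ℤ) → (ℕ → ℤ) → ℕ → ℤ
(f ⊕ g) k = f k + g k
(f ⊖ g) k = f k - g k

_≗[_]_ : {A : Set} → (ℕ → A) → ℕ → (ℕ → A) → Set
f ≗[ n ] g = ∀ {k} → k ≤ n → f k ≡ g k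

≗⇒≗[] : ∀ {A : Set} {f g : ℕ → A} {n} → f ≗ g → f ≗[ n ] g
≗⇒≗[] f≗g {k} _ = f≗g k

-- The product of exponential generating functions, defined through the
-- Leibniz rule ∂ (f ⋆ g) = ∂ f ⋆ g + f ⋆ ∂ g.
_⋆_ : (ℕ → ℤ) → (ℕ → ℤ) → ℕ → ℤ
(f ⋆ g) zero = f 0 * g 0
(f ⋆ g) (suc n) = (∂ f ⋆ g) n + (f ⋆ ∂ g) n

⋆-cong : ∀ {f f′ g g′} n → f ≗[ n ] f′ → g ≗[ n ] g′ → (f ⋆ g) n ≡ (f′ ⋆ g′) n
⋆-cong zero f≗ g≗ = cong₂ _*_ (f≗ z≤n) (g≗ z≤n)
⋆-cong (suc n) f≗ g≗ =
  cong₂ _+_ (⋆-cong n (f≗ ∘ s≤s) (g≗ ∘ ℕₚ.m≤n⇒m≤1+n)) (⋆-cong n (f≗ ∘ ℕₚ.m≤n⇒m≤1+n) (g≗ ∘ s≤s))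

⋆-Leibniz : ∀ {f g F G} n → ∂ f ≗[ n ] F → ∂ g ≗[ n ] G → (f ⋆ g) (suc n) ≡ (F ⋆ g) n + (f ⋆ G) n
⋆-Leibniz n ∂f≗ ∂g≗ = cong₂ _+_ (⋆-cong n ∂f≗ (λ _ → refl)) (⋆-cong n (λ _ → refl) ∂g≗)

⋆-comm : ∀ f g n → (f ⋆ g) n ≡ (g ⋆ f) n
⋆-comm f g zero = ℤ.*-comm (f 0) (g 0)
⋆-comm f g (suc n) =
  trans (cong₂ _+_ (⋆-comm (∂ f) g n) (⋆-comm f (∂ g) n)) (ℤ.+-comm ((g ⋆ ∂ f) n) ((∂ g ⋆ f) n))

⋆-distribˡ-⊕ : ∀ f g h n → (f ⋆ (g ⊕ h)) n ≡ (f ⋆ g) n + (f ⋆ h) n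
⋆-distribˡ-⊕ f g h zero = ℤ.*-distribˡ-+ (f 0) (g 0) (h 0)
⋆-distribˡ-⊕ f g h (suc n) =
  trans (cong₂ _+_ (⋆-distribˡ-⊕ (∂ f) g h n) (⋆-distribˡ-⊕ f (∂ g) (∂ h) n))
        (interchange ℤ.+-commutativeSemigroup ((∂ f ⋆ g) n) ((∂ f ⋆ h) n) ((f ⋆ ∂ g) n) ((f ⋆ ∂ h) n))

⋆-distribʳ-⊕ : ∀ f g h n → ((g ⊕ h) ⋆ f) n ≡ (g ⋆ f) n + (h ⋆ f) n
⋆-distribʳ-⊕ f g h n = begin
  ((g ⊕ h) ⋆ f) n         ≡⟨ ⋆-comm (g ⊕ h) f n ⟩
  (f ⋆ (g ⊕ h)) n         ≡⟨ ⋆-distribˡ-⊕ f g h n ⟩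
  (f ⋆ g) n + (f ⋆ h) n   ≡⟨ cong₂ _+_ (⋆-comm f g n) (⋆-comm f h n) ⟩
  (g ⋆ f) n + (h ⋆ f) n   ∎
  where open ≡-Reasoning

⋆-negʳ : ∀ f g n → (f ⋆ (-_ ∘ g)) n ≡ - (f ⋆ g) n
⋆-negʳ f g zero = sym (ℤ.neg-distribʳ-* (f 0) (g 0))
⋆-negʳ f g (suc n) =
  trans (cong₂ _+_ (⋆-negʳ (∂ f) g n) (⋆-negʳ f (∂ g) n)) (sym (ℤ.neg-distrib-+ ((∂ f ⋆ g) n) ((f ⋆ ∂ g) n)))

⋆-distribˡ-⊖ : ∀ f g h n → (f ⋆ (g ⊖ h)) n ≡ (f ⋆ g) n - (f ⋆ h) n
⋆-distribˡ-⊖ f g h n =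
  trans (⋆-distribˡ-⊕ f g (-_ ∘ h) n) (cong (_+_ ((f ⋆ g) n)) (⋆-negʳ f h n))

⋆-zeroʳ : ∀ f n → (f ⋆ (λ _ → + 0)) n ≡ + 0
⋆-zeroʳ f zero = ℤ.*-zeroʳ (f 0)
⋆-zeroʳ f (suc n) = cong₂ _+_ (⋆-zeroʳ (∂ f) n) (⋆-zeroʳ f n)

⋆-identityʳ : ∀ f n → (f ⋆ δ0) n ≡ f n
⋆-identityʳ f zero = ℤ.*-identityʳ (f 0)
⋆-identityʳ f (suc n) =
  trans (cong₂ _+_ (⋆-identityʳ (∂ f) n) (⋆-zeroʳ f n)) (ℤ.+-identityʳ _)

⋆-assoc : ∀ f g h n → ((f ⋆ g) ⋆ h) n ≡ (f ⋆ (g ⋆ h)) n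
⋆-assoc f g h zero = ℤ.*-assoc (f 0) (g 0) (h 0)
⋆-assoc f g h (suc n) = begin
  ((∂ f ⋆ g ⊕ f ⋆ ∂ g) ⋆ h) n + ((f ⋆ g) ⋆ ∂ h) n
    ≡⟨ cong (_+ ((f ⋆ g) ⋆ ∂ h) n) (⋆-distribʳ-⊕ h (∂ f ⋆ g) (f ⋆ ∂ g) n) ⟩
  ((∂ f ⋆ g) ⋆ h) n + ((f ⋆ ∂ g) ⋆ h) n + ((f ⋆ g) ⋆ ∂ h) n
    ≡⟨ cong₂ _+_ (cong₂ _+_ (⋆-assoc (∂ f) g h n) (⋆-assoc f (∂ g) h n)) (⋆-assoc f g (∂ h) n) ⟩
  (∂ f ⋆ (g ⋆ h)) n + (f ⋆ (∂ g ⋆ h)) n + (f ⋆ (g ⋆ ∂ h)) n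
    ≡⟨ ℤ.+-assoc ((∂ f ⋆ (g ⋆ h)) n) ((f ⋆ (∂ g ⋆ h)) n) ((f ⋆ (g ⋆ ∂ h)) n) ⟩
  (∂ f ⋆ (g ⋆ h)) n + ((f ⋆ (∂ g ⋆ h)) n + (f ⋆ (g ⋆ ∂ h)) n)
    ≡⟨ cong (_+_ ((∂ f ⋆ (g ⋆ h)) n)) (⋆-distribˡ-⊕ f (∂ g ⋆ h) (g ⋆ ∂ h) n) ⟨
  (∂ f ⋆ (g ⋆ h)) n + (f ⋆ (∂ g ⋆ h ⊕ g ⋆ ∂ h)) n
    ∎
  where open ≡-Reasoning

-- Secant and tangent

cosc-∂ : ∀ n → ∂ cosc n ≡ - sinc n
cosc-∂ zero = refl
cosc-∂ (suc zero) = refl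
cosc-∂ (suc (suc n)) = cong -_ (cosc-∂ n)

sinc-∂ : ∀ n → ∂ sinc n ≡ cosc n
sinc-∂ zero = refl
sinc-∂ (suc zero) = refl
sinc-∂ (suc (suc n)) = cong -_ (sinc-∂ n)

module SecTan (a b : ℕ → ℤ) (a₀ : a 0 ≡ + 1) (b₀ : b 0 ≡ + 0)
              (∂a : ∂ a ≗ a ⋆ b) (∂b : ∂ b ≗ a ⋆ a) where

  -- a and b are sec and tan: sec·cos = 1, tan·cos = sin, sec·sin = tan
  -- and tan·sin = sec − cos as exponential generating functions.
  record Identities (n : ℕ) : Set where
    field
      sec·cos : (a ⋆ cosc) n ≡ δ0 n
      tan·cos : (b ⋆ cosc) n ≡ sinc n
      sec·sin : (a ⋆ sinc) n ≡ b n
      tan·sin : (b ⋆ sinc) n ≡ a n - cosc n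

  open Identities

  identities-zero : Identities 0
  identities-zero = record
    { sec·cos = trans (ℤ.*-identityʳ (a 0)) a₀
    ; tan·cos = trans (ℤ.*-identityʳ (b 0)) b₀
    ; sec·sin = trans (ℤ.*-zeroʳ (a 0)) (sym b₀)
    ; tan·sin = trans (ℤ.*-zeroʳ (b 0)) (cong (_- + 1) (sym a₀))
    }

  identities-suc : ∀ n → (∀ {k} → k ≤ n → Identities k) → Identities (suc n)
  identities-suc n ih = record
    { sec·cos = begin
        (a ⋆ cosc) (suc n)
          ≡⟨ ⋆-Leibniz n (≗⇒≗[] ∂a) (≗⇒≗[] cosc-∂) ⟩
        ((a ⋆ b) ⋆ cosc) n + (a ⋆ (-_ ∘ sinc)) n
          ≡⟨ cong₂ _+_ (⋆-assoc a b cosc n) (⋆-negʳ a sinc n) ⟩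
        (a ⋆ (b ⋆ cosc)) n - (a ⋆ sinc) n
          ≡⟨ cong (_- (a ⋆ sinc) n) (⋆-cong n (λ _ → refl) (tan·cos ∘ ih)) ⟩
        (a ⋆ sinc) n - (a ⋆ sinc) n
          ≡⟨ ℤ.+-inverseʳ ((a ⋆ sinc) n) ⟩
        + 0
          ∎
    ; tan·cos = begin
        (b ⋆ cosc) (suc n)
          ≡⟨ ⋆-Leibniz n (≗⇒≗[] ∂b) (≗⇒≗[] cosc-∂) ⟩
        ((a ⋆ a) ⋆ cosc) n + (b ⋆ (-_ ∘ sinc)) n
          ≡⟨ cong₂ _+_ (⋆-assoc a a cosc n) (⋆-negʳ b sinc n) ⟩
        (a ⋆ (a ⋆ cosc)) n - (b ⋆ sinc) n
          ≡⟨ cong₂ _-_ (⋆-cong n (λ _ → refl) (sec·cos ∘ ih)) (tan·sin (ih ℕₚ.≤-refl)) ⟩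
        (a ⋆ δ0) n - (a n - cosc n)
          ≡⟨ cong (_- (a n - cosc n)) (⋆-identityʳ a n) ⟩
        a n - (a n - cosc n)
          ≡⟨ x-[x-y]≡y (a n) (cosc n) ⟩
        cosc n
          ≡⟨ sinc-∂ n ⟨
        sinc (suc n)
          ∎
    ; sec·sin = begin
        (a ⋆ sinc) (suc n)
          ≡⟨ ⋆-Leibniz n (≗⇒≗[] ∂a) (≗⇒≗[] sinc-∂) ⟩
        ((a ⋆ b) ⋆ sinc) n + (a ⋆ cosc) n
          ≡⟨ cong₂ _+_ (⋆-assoc a b sinc n) (sec·cos (ih ℕₚ.≤-refl)) ⟩
        (a ⋆ (b ⋆ sinc)) n + δ0 n
          ≡⟨ cong (_+ δ0 n) (⋆-cong n (λ _ → refl) (tan·sin ∘ ih)) ⟩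
        (a ⋆ (a ⊖ cosc)) n + δ0 n
          ≡⟨ cong (_+ δ0 n) (⋆-distribˡ-⊖ a a cosc n) ⟩
        (a ⋆ a) n - (a ⋆ cosc) n + δ0 n
          ≡⟨ cong (λ z → (a ⋆ a) n - z + δ0 n) (sec·cos (ih ℕₚ.≤-refl)) ⟩
        (a ⋆ a) n - δ0 n + δ0 n
          ≡⟨ x-y+y≡x ((a ⋆ a) n) (δ0 n) ⟩
        (a ⋆ a) n
          ≡⟨ ∂b n ⟨
        b (suc n)
          ∎
    ; tan·sin = begin
        (b ⋆ sinc) (suc n)
          ≡⟨ ⋆-Leibniz n (≗⇒≗[] ∂b) (≗⇒≗[] sinc-∂) ⟩
        ((a ⋆ a) ⋆ sinc) n + (b ⋆ cosc) n
          ≡⟨ cong₂ _+_ (⋆-assoc a a sinc n) (tan·cos (ih ℕₚ.≤-refl)) ⟩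
        (a ⋆ (a ⋆ sinc)) n + sinc n
          ≡⟨ cong₂ _+_ (⋆-cong n (λ _ → refl) (sec·sin ∘ ih)) (sym (ℤ.neg-involutive (sinc n))) ⟩
        (a ⋆ b) n - - sinc n
          ≡⟨ cong₂ _-_ (∂a n) (cosc-∂ n) ⟨
        a (suc n) - cosc (suc n)
          ∎
    }
    where
    open ≡-Reasoning
    x-[x-y]≡y : ∀ x y → x - (x - y) ≡ y
    x-[x-y]≡y = solve-∀
    x-y+y≡x : ∀ x y → x - y + y ≡ x
    x-y+y≡x = solve-∀

  sec+tan⋆cos : ∀ n → ((a ⊕ b) ⋆ cosc) n ≡ δ0 n + sinc n
  sec+tan⋆cos n = trans (⋆-distribʳ-⊕ cosc a b n) (cong₂ _+_ (sec·cos identities) (tan·cos identities))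
    where
    identities : Identities n
    identities = strong-induction Identities identities-zero identities-suc n

sumBelow : ℕ → (ℕ → ℤ) → ℤ
sumBelow m h = sumℤ (applyUpTo h m)

sumBelow-cong : ∀ m {h h′} → (∀ {k} → k < m → h k ≡ h′ k) → sumBelow m h ≡ sumBelow m h′
sumBelow-cong zero h≗ = refl
sumBelow-cong (suc m) h≗ = cong₂ _+_ (h≗ (s≤s z≤n)) (sumBelow-cong m (h≗ ∘ s≤s))

sumBelow-⊕ : ∀ m h h′ → sumBelow m (h ⊕ h′) ≡ sumBelow m h + sumBelow m h′
sumBelow-⊕ zero h h′ = refl
sumBelow-⊕ (suc m) h h′ =
  trans (cong (_+_ (h 0 + h′ 0)) (sumBelow-⊕ m (∂ h) (∂ h′)))
        (interchange ℤ.+-commutativeSemigroup (h 0) (h′ 0) (sumBelow m (∂ h)) (sumBelow m (∂ h′)))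

sumBelow-suc : ∀ m h → sumBelow (suc m) h ≡ sumBelow m h + h m
sumBelow-suc zero h = ℤ.+-comm (h 0) (+ 0)
sumBelow-suc (suc m) h =
  trans (cong (_+_ (h 0)) (sumBelow-suc m (∂ h))) (sym (ℤ.+-assoc (h 0) (sumBelow m (∂ h)) (h (suc m))))

binomialTerm : (ℕ → ℤ) → (ℕ → ℤ) → ℕ → ℕ → ℤ
binomialTerm f g n k = + (n C k) * f k * g (n ∸ k)

⋆-binomial : ∀ f g n → (f ⋆ g) n ≡ sumBelow (suc n) (binomialTerm f g n)
⋆-binomial f g zero = sym (trans (ℤ.+-identityʳ (+ 1 * f 0 * g 0)) (cong (_* g 0) (ℤ.*-identityˡ (f 0))))
⋆-binomial f g (suc n) = begin
  (∂ f ⋆ g) n + (f ⋆ ∂ g) n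
    ≡⟨ cong₂ _+_ (⋆-binomial (∂ f) g n) (⋆-binomial f (∂ g) n) ⟩
  sumBelow (suc n) ∂f-term + (t₀ + sumBelow n (∂ (binomialTerm f (∂ g) n)))
    ≡⟨ cong (λ z → sumBelow (suc n) ∂f-term + (t₀ + z)) ∂g-terms-sum ⟩
  sumBelow (suc n) ∂f-term + (t₀ + sumBelow (suc n) ∂g-term)
    ≡⟨ x+[y+z]≡y+[x+z] (sumBelow (suc n) ∂f-term) t₀ (sumBelow (suc n) ∂g-term) ⟩
  t₀ + (sumBelow (suc n) ∂f-term + sumBelow (suc n) ∂g-term)
    ≡⟨ cong (_+_ t₀) (sumBelow-⊕ (suc n) ∂f-term ∂g-term) ⟨
  t₀ + sumBelow (suc n) (∂f-term ⊕ ∂g-term)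
    ≡⟨ cong (_+_ t₀) (sumBelow-cong (suc n) λ {k} _ → Pascal k) ⟩
  t₀ + sumBelow (suc n) (∂ (binomialTerm f g (suc n)))
    ∎
  where
  open ≡-Reasoning
  x+[y+z]≡y+[x+z] : ∀ x y z → x + (y + z) ≡ y + (x + z)
  x+[y+z]≡y+[x+z] = solve-∀
  t₀ : ℤ
  t₀ = + 1 * f 0 * g (suc n)
  ∂f-term : ℕ → ℤ
  ∂f-term = binomialTerm (∂ f) g n
  ∂g-term : ℕ → ℤ
  ∂g-term k = + (n C suc k) * f (suc k) * g (n ∸ k)
  ∂g-terms-sum : sumBelow n (∂ (binomialTerm f (∂ g) n)) ≡ sumBelow (suc n) ∂g-term
  ∂g-terms-sum = begin
    sumBelow n (∂ (binomialTerm f (∂ g) n))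
      ≡⟨ sumBelow-cong n (λ {k} k<n → cong (λ m → + (n C suc k) * f (suc k) * g m) (sym (ℕₚ.+-∸-assoc 1 k<n))) ⟩
    sumBelow n ∂g-term
      ≡⟨ ℤ.+-identityʳ (sumBelow n ∂g-term) ⟨
    sumBelow n ∂g-term + + 0
      ≡⟨ cong (λ c → sumBelow n ∂g-term + + c * f (suc n) * g (n ∸ n)) (k>n⇒nCk≡0 (ℕₚ.n<1+n n)) ⟨
    sumBelow n ∂g-term + ∂g-term n
      ≡⟨ sumBelow-suc n ∂g-term ⟨
    sumBelow (suc n) ∂g-term
      ∎
  Pascal : ∀ k → (∂f-term ⊕ ∂g-term) k ≡ ∂ (binomialTerm f g (suc n)) k
  Pascal k = begin
    + (n C k) * f (suc k) * g (n ∸ k) + + (n C suc k) * f (suc k) * g (n ∸ k)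
      ≡⟨ ℤ.*-distribʳ-+ (g (n ∸ k)) (+ (n C k) * f (suc k)) (+ (n C suc k) * f (suc k)) ⟨
    (+ (n C k) * f (suc k) + + (n C suc k) * f (suc k)) * g (n ∸ k)
      ≡⟨ cong (_* g (n ∸ k)) (ℤ.*-distribʳ-+ (f (suc k)) (+ (n C k)) (+ (n C suc k))) ⟨
    (+ (n C k) + + (n C suc k)) * f (suc k) * g (n ∸ k)
      ≡⟨ cong (λ c → + c * f (suc k) * g (n ∸ k)) (nCk+nC[k+1]≡[n+1]C[k+1] n k) ⟩
    + (suc n C suc k) * f (suc k) * g (n ∸ k)
      ∎

eulers≡map-euler : ∀ n → eulers n ≡ map euler (upTo n)
eulers≡map-euler zero = refl
eulers≡map-euler (suc n) = begin
  eulers n ++ [ euler n ]             ≡⟨ cong (_++ [ euler n ]) (eulers≡map-euler n) ⟩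
  map euler (upTo n) ++ [ euler n ]   ≡⟨ List.map-++ euler (upTo n) [ n ] ⟨
  map euler (upTo n ++ [ n ])         ≡⟨ cong (map euler) (List.upTo-∷ʳ n) ⟩
  map euler (upTo (suc n))            ∎
  where open ≡-Reasoning

zipWith-map-diagonal : ∀ {A B C : Set} (F : A → B → C) (h : A → B) xs →
                       zipWith F xs (map h xs) ≡ map (λ x → F x (h x)) xs
zipWith-map-diagonal F h [] = refl
zipWith-map-diagonal F h (x ∷ xs) = cong (F x (h x) ∷_) (zipWith-map-diagonal F h xs)

euler-recurrence : ∀ n → euler n ≡ δ0 n + sinc n - sumBelow n (binomialTerm euler cosc n)
euler-recurrence n = cong (λ es → δ0 n + sinc n - sumℤ es) (begin
  zipWith term (upTo n) (eulers n)                ≡⟨ cong (zipWith term (upTo n)) (eulers≡map-euler n) ⟩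
  zipWith term (upTo n) (map euler (upTo n))      ≡⟨ zipWith-map-diagonal term euler (upTo n) ⟩
  map (λ k → term k (euler k)) (upTo n)           ≡⟨ List.map-upTo (λ k → term k (euler k)) n ⟩
  applyUpTo (binomialTerm euler cosc n) n         ∎)
  where
  open ≡-Reasoning
  term : ℕ → ℤ → ℤ
  term k e = + (n C k) * e * cosc (n ∸ k)

-- The coefficient of cosc 0 = 1 in the binomial expansion of (e ⋆ cosc) n is
-- e n itself, so the identity determines e n from the earlier values.
euler-unique : ∀ e → (∀ n → (e ⋆ cosc) n ≡ δ0 n + sinc n) → e ≗ euler
euler-unique e e⋆cos = <-rec (λ n → e n ≡ euler n) step
  where
  step : ∀ n → (∀ {k} → k < n → e k ≡ euler k) → e n ≡ euler n
  step n ih = begin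
    e n
      ≡⟨ x≡[y+x]-y (e n) (earlier e) ⟩
    earlier e + e n - earlier e
      ≡⟨ cong (λ z → earlier e + z - earlier e) (last-term e) ⟨
    earlier e + binomialTerm e cosc n n - earlier e
      ≡⟨ cong (_- earlier e) (sumBelow-suc n (binomialTerm e cosc n)) ⟨
    sumBelow (suc n) (binomialTerm e cosc n) - earlier e
      ≡⟨ cong₂ _-_ expansion (sumBelow-cong n λ {k} k<n → cong (λ x → + (n C k) * x * cosc (n ∸ k)) (ih k<n)) ⟩
    δ0 n + sinc n - earlier euler
      ≡⟨ euler-recurrence n ⟨
    euler n
      ∎
    where
    open ≡-Reasoning
    earlier : (ℕ → ℤ) → ℤ
    earlier f = sumBelow n (binomialTerm f cosc n)
    expansion : sumBelow (suc n) (binomialTerm e cosc n) ≡ δ0 n + sinc n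
    expansion = trans (sym (⋆-binomial e cosc n)) (e⋆cos n)
    last-term : ∀ f → binomialTerm f cosc n n ≡ f n
    last-term f = begin
      + (n C n) * f n * cosc (n ∸ n)   ≡⟨ cong₂ (λ c m → + c * f n * cosc m) (nCn≡1 n) (ℕₚ.n∸n≡0 n) ⟩
      + 1 * f n * + 1                  ≡⟨ ℤ.*-identityʳ (+ 1 * f n) ⟩
      + 1 * f n                        ≡⟨ ℤ.*-identityˡ (f n) ⟩
      f n                              ∎
    x≡[y+x]-y : ∀ x y → x ≡ y + x - y
    x≡[y+x]-y = solve-∀

-- Splitting a list into two complementary subsequences

splits : {A : Set} → List A → List (List A × List A)
splits [] = [ ([] , []) ]
splits (y ∷ ys) = map (Product.map₁ (y ∷_)) (splits ys) ++ map (Product.map₂ (y ∷_)) (splits ys)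

module _ {A : Set} where

  splits-↭ : ∀ {ys u v : List A} → (u , v) ∈ splits ys → u ++ v ↭ ys
  splits-↭ {[]} (here refl) = ↭-refl
  splits-↭ {y ∷ ys} uv∈ with ∈-++⁻ (map (Product.map₁ (y ∷_)) (splits ys)) uv∈
  ... | inj₁ uv∈₁ with (u , v) , uv∈′ , refl ← ∈-map⁻ (Product.map₁ (y ∷_)) uv∈₁ = prep y (splits-↭ uv∈′)
  ... | inj₂ uv∈₂ with (u , v) , uv∈′ , refl ← ∈-map⁻ (Product.map₂ (y ∷_)) uv∈₂ =
    ↭-trans (shift y u v) (prep y (splits-↭ uv∈′))

  splits-All : ∀ {P : A → Set} {ys u v} → (u , v) ∈ splits ys → All P ys → All P u × All P v
  splits-All {u = u} uv∈ Pys = All.++⁻ u (All-resp-↭ (↭-sym (splits-↭ uv∈)) Pys)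

  splits-length : ∀ {ys u v : List A} → (u , v) ∈ splits ys → length u ≤ length ys × length v ≤ length ys
  splits-length {ys} {u} {v} uv∈ =
    ℕₚ.≤-trans (List.length-++-≤ˡ u) (ℕₚ.≤-reflexive |u++v|≡|ys|) ,
    ℕₚ.≤-trans (List.length-++-≤ʳ v {u}) (ℕₚ.≤-reflexive |u++v|≡|ys|)
    where
    |u++v|≡|ys| : length (u ++ v) ≡ length ys
    |u++v|≡|ys| = ↭-length (splits-↭ {ys} uv∈)

  splits-AllPairs : ∀ {R : A → A → Set} {ys u v} → AllPairs R ys → (u , v) ∈ splits ys →
                    AllPairs R u × AllPairs R v
  splits-AllPairs {ys = []} [] (here refl) = [] , []
  splits-AllPairs {ys = y ∷ ys} (Ry ∷ Rys) uv∈ with ∈-++⁻ (map (Product.map₁ (y ∷_)) (splits ys)) uv∈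
  ... | inj₁ uv∈₁ with (u , v) , uv∈′ , refl ← ∈-map⁻ (Product.map₁ (y ∷_)) uv∈₁ =
    Product.map₁ (proj₁ (splits-All uv∈′ Ry) ∷_) (splits-AllPairs Rys uv∈′)
  ... | inj₂ uv∈₂ with (u , v) , uv∈′ , refl ← ∈-map⁻ (Product.map₂ (y ∷_)) uv∈₂ =
    Product.map₂ (proj₂ (splits-All uv∈′ Ry) ∷_) (splits-AllPairs Rys uv∈′)

  splits-complete : ∀ {ys} (a b : List A) → a ++ b ↭ ys →
                    ∃ λ ((u , v) : List A × List A) → (u , v) ∈ splits ys × a ↭ u × b ↭ v
  splits-complete {[]} a b a++b↭[] with [] ← a | [] ← b | refl ← ↭-empty-inv a++b↭[] =
    _ , here refl , ↭-refl , ↭-refl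
  splits-complete {y ∷ ys} a b a++b↭ with ∈-++⁻ a (∈-resp-↭ (↭-sym a++b↭) (here refl))
  ... | inj₁ y∈a with a₁ , a₂ , refl ← ∈-∃++ y∈a =
    let (u , v) , uv∈ , a↭u , b↭v = splits-complete (a₁ ++ a₂) b (drop-∷ (↭-trans y-first a++b↭))
    in  (y ∷ u , v) , ∈-++⁺ˡ (∈-map⁺ (Product.map₁ (y ∷_)) uv∈) , ↭-trans (shift y a₁ a₂) (prep y a↭u) , b↭v
    where
    y-first : y ∷ (a₁ ++ a₂) ++ b ↭ (a₁ ++ y ∷ a₂) ++ b
    y-first = ↭-sym (++⁺ʳ b (shift y a₁ a₂))
  ... | inj₂ y∈b with b₁ , b₂ , refl ← ∈-∃++ y∈b =
    let (u , v) , uv∈ , a↭u , b↭v = splits-complete a (b₁ ++ b₂) (drop-∷ (↭-trans y-first a++b↭))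
    in  (u , y ∷ v) , ∈-++⁺ʳ (map (Product.map₁ (y ∷_)) (splits ys)) (∈-map⁺ (Product.map₂ (y ∷_)) uv∈) ,
        a↭u , ↭-trans (shift y b₁ b₂) (prep y b↭v)
    where
    y-first : y ∷ a ++ b₁ ++ b₂ ↭ a ++ b₁ ++ y ∷ b₂
    y-first = ↭-trans (↭-sym (shift y a (b₁ ++ b₂))) (++⁺ˡ a (↭-sym (shift y b₁ b₂)))

  splits-unique : ∀ {ys : List A} → Unique ys → Unique (splits ys)
  splits-unique {[]} [] = [] ∷ []
  splits-unique {y ∷ ys} (y∉ys ∷ unique) =
    Unique.++⁺ (Unique.map⁺ map₁-injective (splits-unique unique))
               (Unique.map⁺ map₂-injective (splits-unique unique))
               disjoint
    where
    map₁-injective : ∀ {p q : List A × List A} → Product.map₁ (y ∷_) p ≡ Product.map₁ (y ∷_) q → p ≡ q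
    map₁-injective refl = refl
    map₂-injective : ∀ {p q : List A × List A} → Product.map₂ (y ∷_) p ≡ Product.map₂ (y ∷_) q → p ≡ q
    map₂-injective refl = refl
    disjoint : ∀ {p} → p ∈ map (Product.map₁ (y ∷_)) (splits ys) × p ∈ map (Product.map₂ (y ∷_)) (splits ys) → ⊥
    disjoint (p∈₁ , p∈₂)
      with _ , _ , refl ← ∈-map⁻ (Product.map₁ (y ∷_)) p∈₁
      with (_ , v) , uv∈ , refl ← ∈-map⁻ (Product.map₂ (y ∷_)) p∈₂
      = All.lookup y∉ys (∈-resp-↭ (splits-↭ uv∈) (∈-++⁺ˡ {ys = v} (here refl))) refl

  splits-count : ∀ {B : Set} (F : List A × List A → List B) (α β : ℕ → ℤ) →
                 (∀ u v → + length (F (u , v)) ≡ α (length u) * β (length v)) →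
                 ∀ ys → + length (concatMap F (splits ys)) ≡ (α ⋆ β) (length ys)
  splits-count F α β |F| [] = trans (cong (λ l → + length l) (List.++-identityʳ (F ([] , [])))) (|F| [] [])
  splits-count F α β |F| (y ∷ ys) = begin
    + length (concatMap F (map left S ++ map right S))
      ≡⟨ cong (λ l → + length l) (List.concatMap-++ F (map left S) (map right S)) ⟩
    + length (concatMap F (map left S) ++ concatMap F (map right S))
      ≡⟨ cong +_ (List.length-++ (concatMap F (map left S))) ⟩
    + (length (concatMap F (map left S)) ℕ.+ length (concatMap F (map right S)))
      ≡⟨ ℤ.pos-+ (length (concatMap F (map left S))) _ ⟩
    + length (concatMap F (map left S)) + + length (concatMap F (map right S))
      ≡⟨ cong₂ (λ l r → + length l + + length r) (List.concatMap-map F left S) (List.concatMap-map F right S) ⟩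
    + length (concatMap (F ∘ left) S) + + length (concatMap (F ∘ right) S)
      ≡⟨ cong₂ _+_ (splits-count (F ∘ left) (∂ α) β (λ u → |F| (y ∷ u)) ys)
                   (splits-count (F ∘ right) α (∂ β) (λ u v → |F| u (y ∷ v)) ys) ⟩
    (∂ α ⋆ β) (length ys) + (α ⋆ ∂ β) (length ys)
      ∎
    where
    open ≡-Reasoning
    S : List (List A × List A)
    S = splits ys
    left right : List A × List A → List A × List A
    left = Product.map₁ (y ∷_)
    right = Product.map₂ (y ∷_)

↭-∷-least⁻ : ∀ {x y xs ys} → All (x <_) xs → All (y <_) ys → x ∷ xs ↭ y ∷ ys → x ≡ y × xs ↭ ys
↭-∷-least⁻ x<xs y<ys p with ∈-resp-↭ p (here refl) | ∈-resp-↭ (↭-sym p) (here refl)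
... | here refl | _ = refl , drop-∷ p
... | there x∈ys | here refl = refl , drop-∷ p
... | there x∈ys | there y∈xs = ⊥-elim (ℕₚ.<-asym (All.lookup y<ys x∈ys) (All.lookup x<xs y∈xs))

sorted-↭⇒≡ : ∀ {xs ys} → AllPairs _<_ xs → AllPairs _<_ ys → xs ↭ ys → xs ≡ ys
sorted-↭⇒≡ {[]} _ _ []↭ys = sym (↭-empty-inv (↭-sym []↭ys))
sorted-↭⇒≡ {x ∷ xs} {[]} _ _ xs↭[] with () ← ↭-empty-inv xs↭[]
sorted-↭⇒≡ {x ∷ xs} {y ∷ ys} (x< ∷ xs-sorted) (y< ∷ ys-sorted) p
  with refl , xs↭ys ← ↭-∷-least⁻ x< y< p = cong (x ∷_) (sorted-↭⇒≡ xs-sorted ys-sorted xs↭ys)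

All-labelsF⇒All-label : ∀ {P : ℕ → Set} ts → All P (labelsF ts) → All (P ∘ label) ts
All-labelsF⇒All-label [] _ = []
All-labelsF⇒All-label (node l cs ∷ ts) P-labels with P-root ∷ _ , P-rest ← All.++⁻ (l ∷ labelsF cs) P-labels =
  P-root ∷ All-labelsF⇒All-label ts P-rest

Ascending-∷⇔ : ∀ {x} ys → Ascending (x ∷ ys) ⇔ (All (x <_) ys × Ascending ys)
Ascending-∷⇔ [] = mk⇔ (λ _ → [] , tt) (λ _ → tt)
Ascending-∷⇔ (y ∷ ys) = mk⇔
  (λ (x<y , asc) → x<y ∷ All.map (ℕₚ.<-trans x<y) (proj₁ (Equivalence.to (Ascending-∷⇔ ys) asc)) , asc)
  (λ (x<ys , asc) → All.head x<ys , asc)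

labelsF-above : ∀ {l} ts → All (λ t → l < label t) ts → IncreasingF ts → All (l <_) (labelsF ts)
labelsF-above [] [] _ = []
labelsF-above (node m cs ∷ ts) (l<m ∷ l<ts) ((m<cs , _ , cs-inc) , ts-inc) =
  All.++⁺ (l<m ∷ All.map (ℕₚ.<-trans l<m) (labelsF-above cs m<cs cs-inc)) (labelsF-above ts l<ts ts-inc)

labelsF-above-first-root : ∀ y f g → IncreasingF (node y f ∷ g) → Ascending (y ∷ map label g) →
                           All (y <_) (labelsF f ++ labelsF g)
labelsF-above-first-root y f g ((y<f , _ , f-inc) , g-inc) asc =
  All.++⁺ (labelsF-above f y<f f-inc)
          (labelsF-above g (All.map⁻ (proj₁ (Equivalence.to (Ascending-∷⇔ (map label g)) asc))) g-inc)

-- Forests without even nodes on even levels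

data LengthCond : Set where
  anyLength evenLength oddLength : LengthCond

Satisfies : LengthCond → ℕ → Set
Satisfies anyLength _ = ⊤
Satisfies evenLength zero = ⊤
Satisfies evenLength (suc n) = Satisfies oddLength n
Satisfies oddLength zero = ⊥
Satisfies oddLength (suc n) = Satisfies evenLength n

tailCond : LengthCond → LengthCond
tailCond anyLength = anyLength
tailCond evenLength = oddLength
tailCond oddLength = evenLength

Satisfies-suc : ∀ c n → Satisfies c (suc n) ⇔ Satisfies (tailCond c) n
Satisfies-suc anyLength n = mk⇔ id id
Satisfies-suc evenLength n = mk⇔ id id
Satisfies-suc oddLength n = mk⇔ id id

childCond : Bool → LengthCond
childCond true = oddLength
childCond false = anyLength

oddLength⇔isEven≡false : ∀ n → Satisfies oddLength n ⇔ isEven n ≡ false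
oddLength⇔isEven≡false zero = mk⇔ ⊥-elim (λ ())
oddLength⇔isEven≡false (suc zero) = mk⇔ (λ _ → refl) (λ _ → tt)
oddLength⇔isEven≡false (suc (suc n)) = oddLength⇔isEven≡false n

∧-isEven≡false⇔childCond : ∀ b n → b ∧ isEven n ≡ false ⇔ Satisfies (childCond b) n
∧-isEven≡false⇔childCond true n = ⇔.sym (oddLength⇔isEven≡false n)
∧-isEven≡false⇔childCond false n = mk⇔ (λ _ → tt) (λ _ → refl)

eeAtF-∷≡0⇔ : ∀ d x f g → eeAtF d (node x f ∷ g) ≡ 0 ⇔
             (Satisfies (childCond (isEven d)) (length f) × eeAtF (suc d) f ≡ 0 × eeAtF d g ≡ 0)
eeAtF-∷≡0⇔ d x f g with isEven d ∧ isEven (length f) in counted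
... | true = mk⇔ (λ ()) (λ (uncounted , _) → case trans (sym counted) (from uncounted) of λ ())
  where open Equivalence (∧-isEven≡false⇔childCond (isEven d) (length f))
... | false = mk⇔
  (λ ee≡0 → to counted , ℕₚ.m+n≡0⇒m≡0 (eeAtF (suc d) f) ee≡0 , ℕₚ.m+n≡0⇒n≡0 (eeAtF (suc d) f) ee≡0)
  (λ (_ , f≡0 , g≡0) → cong₂ ℕ._+_ f≡0 g≡0)
  where open Equivalence (∧-isEven≡false⇔childCond (isEven d) (length f))

record ValidForest (d : ℕ) (c : LengthCond) (xs : List ℕ) (ts : List LTree) : Set where
  field
    labels↭ : labelsF ts ↭ xs
    increasing : IncreasingF ts
    ascending : Ascending (map label ts)
    ee≡0 : eeAtF d ts ≡ 0
    satisfies : Satisfies c (length ts)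

valid-[] : ∀ {d c} → Satisfies c 0 → ValidForest d c [] []
valid-[] c₀ = record { labels↭ = ↭-refl ; increasing = tt ; ascending = tt ; ee≡0 = refl ; satisfies = c₀ }

data Decomposition (d : ℕ) (c : LengthCond) (x : ℕ) (rest : List ℕ) : List LTree → Set where
  node-∷ : ∀ {u v f g} → (u , v) ∈ splits rest →
           ValidForest (suc d) (childCond (isEven d)) u f → ValidForest d (tailCond c) v g →
           Decomposition d c x rest (node x f ∷ g)

valid-∷ : ∀ {d c x rest ts} → All (x <_) rest → Decomposition d c x rest ts → ValidForest d c (x ∷ rest) ts
valid-∷ {d} {c} {x} x<rest (node-∷ {u} {v} {f} {g} uv∈ F G) = record
  { labels↭ = prep x (↭-trans (++⁺ F.labels↭ G.labels↭) (splits-↭ uv∈))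
  ; increasing = (All-labelsF⇒All-label f (All-resp-↭ (↭-sym F.labels↭) x<u) , F.ascending , F.increasing) , G.increasing
  ; ascending = Equivalence.from (Ascending-∷⇔ (map label g))
                  (All.map⁺ (All-labelsF⇒All-label g (All-resp-↭ (↭-sym G.labels↭) x<v)) , G.ascending)
  ; ee≡0 = Equivalence.from (eeAtF-∷≡0⇔ d x f g) (F.satisfies , F.ee≡0 , G.ee≡0)
  ; satisfies = Equivalence.from (Satisfies-suc c (length g)) G.satisfies
  }
  where
  module F = ValidForest F
  module G = ValidForest G
  x<u : All (x <_) u
  x<u = proj₁ (splits-All uv∈ x<rest)
  x<v : All (x <_) v
  x<v = proj₂ (splits-All uv∈ x<rest)

valid-∷⁻ : ∀ {d c x rest ts} → AllPairs _<_ (x ∷ rest) → ValidForest d c (x ∷ rest) ts →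
           Decomposition d c x rest ts
valid-∷⁻ {ts = []} _ V with () ← ↭-empty-inv (↭-sym (ValidForest.labels↭ V))
valid-∷⁻ {d} {c} {x} {ts = node y f ∷ g} (x<rest ∷ _)
         record { labels↭ = labels↭ ; increasing = inc@((_ , f-asc , f-inc) , g-inc) ; ascending = asc
                ; ee≡0 = ee≡0 ; satisfies = sat }
  with refl , f++g↭rest ← ↭-∷-least⁻ (labelsF-above-first-root y f g inc asc) x<rest labels↭
  with (u , v) , uv∈ , f↭u , g↭v ← splits-complete (labelsF f) (labelsF g) f++g↭rest
  with f-sat , f-ee , g-ee ← Equivalence.to (eeAtF-∷≡0⇔ d x f g) ee≡0
  = node-∷ uv∈
      (record { labels↭ = f↭u ; increasing = f-inc ; ascending = f-asc ; ee≡0 = f-ee ; satisfies = f-sat })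
      (record { labels↭ = g↭v ; increasing = g-inc
              ; ascending = proj₂ (Equivalence.to (Ascending-∷⇔ (map label g)) asc)
              ; ee≡0 = g-ee ; satisfies = Equivalence.to (Satisfies-suc c (length g)) sat })

emptyForests : LengthCond → List (List LTree)
emptyForests oddLength = []
emptyForests _ = [ [] ]

-- The first argument is fuel: the enumeration is complete as soon as it
-- is at least the number of labels.
mutual
  forests : ℕ → ℕ → LengthCond → List ℕ → List (List LTree)
  forests k d c [] = emptyForests c
  forests zero d c (_ ∷ _) = []
  forests (suc k) d c (x ∷ rest) = concatMap (forestsHeadedBy k d c x) (splits rest)

  forestsHeadedBy : ℕ → ℕ → LengthCond → ℕ → List ℕ × List ℕ → List (List LTree)
  forestsHeadedBy k d c x (u , v) =
    cartesianProductWith (λ f g → node x f ∷ g)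
      (forests k (suc d) (childCond (isEven d)) u)
      (forests k d (tailCond c) v)

emptyForests-sound : ∀ {d} c {ts} → ts ∈ emptyForests c → ValidForest d c [] ts
emptyForests-sound anyLength (here refl) = valid-[] tt
emptyForests-sound evenLength (here refl) = valid-[] tt

emptyForests-complete : ∀ {d} c {ts} → ValidForest d c [] ts → ts ∈ emptyForests c
emptyForests-complete c {node _ _ ∷ _} V with () ← ↭-empty-inv (ValidForest.labels↭ V)
emptyForests-complete anyLength {[]} _ = here refl
emptyForests-complete evenLength {[]} _ = here refl
emptyForests-complete oddLength {[]} V = ⊥-elim (ValidForest.satisfies V)

emptyForests-unique : ∀ c → Unique (emptyForests c)
emptyForests-unique anyLength = [] ∷ []
emptyForests-unique evenLength = [] ∷ []
emptyForests-unique oddLength = []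

forests-sound : ∀ k d c {xs ts} → AllPairs _<_ xs → ts ∈ forests k d c xs → ValidForest d c xs ts
forests-sound k d c {[]} _ ts∈ = emptyForests-sound c ts∈
forests-sound (suc k) d c {x ∷ rest} (x<rest ∷ rest-sorted) ts∈
  with (u , v) , uv∈ , ts∈′ ← find (∈-concatMap⁻ (forestsHeadedBy k d c x) {xs = splits rest} ts∈)
  with f , g , f∈ , g∈ , refl ← ∈-cartesianProductWith⁻ (λ f g → node x f ∷ g)
                                   (forests k (suc d) (childCond (isEven d)) u)
                                   (forests k d (tailCond c) v) ts∈′
  with u-sorted , v-sorted ← splits-AllPairs rest-sorted uv∈
  = valid-∷ x<rest (node-∷ uv∈ (forests-sound k (suc d) (childCond (isEven d)) u-sorted f∈)
                               (forests-sound k d (tailCond c) v-sorted g∈))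

forests-complete : ∀ k d c {xs ts} → AllPairs _<_ xs → length xs ≤ k → ValidForest d c xs ts →
                   ts ∈ forests k d c xs
forests-complete k d c {[]} _ _ V = emptyForests-complete c V
forests-complete (suc k) d c {x ∷ rest} sorted@(_ ∷ rest-sorted) (s≤s |rest|≤k) V
  with node-∷ {u} {v} uv∈ F G ← valid-∷⁻ sorted V
  with u-sorted , v-sorted ← splits-AllPairs rest-sorted uv∈
  with |u|≤|rest| , |v|≤|rest| ← splits-length {ys = rest} uv∈
  = ∈-concatMap⁺ (forestsHeadedBy k d c x) (lose uv∈ (∈-cartesianProductWith⁺ (λ f g → node x f ∷ g)
      (forests-complete k (suc d) (childCond (isEven d)) u-sorted (ℕₚ.≤-trans |u|≤|rest| |rest|≤k) F)
      (forests-complete k d (tailCond c) v-sorted (ℕₚ.≤-trans |v|≤|rest| |rest|≤k) G)))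

Unique-concatMap⁺ : ∀ {A B : Set} (F : A → List B) {xs} → Unique xs → (∀ {a} → a ∈ xs → Unique (F a)) →
                    (∀ {a a′ z} → a ∈ xs → a′ ∈ xs → z ∈ F a → z ∈ F a′ → a ≡ a′) → Unique (concatMap F xs)
Unique-concatMap⁺ F {[]} _ _ _ = []
Unique-concatMap⁺ F {a ∷ as} (a∉as ∷ as-unique) F-unique F-disjoint =
  Unique.++⁺ (F-unique (here refl))
             (Unique-concatMap⁺ F as-unique (F-unique ∘ there) (λ m m′ → F-disjoint (there m) (there m′)))
    λ (z∈Fa , z∈Fas) → let a′ , a′∈as , z∈Fa′ = find (∈-concatMap⁻ F {xs = as} z∈Fas)
                       in All.lookup a∉as a′∈as (F-disjoint (here refl) (there a′∈as) z∈Fa z∈Fa′)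

forests-labels-unique : ∀ k d c {xs ys ts} → AllPairs _<_ xs → AllPairs _<_ ys →
                        ts ∈ forests k d c xs → ts ∈ forests k d c ys → xs ≡ ys
forests-labels-unique k d c xs-sorted ys-sorted ts∈xs ts∈ys =
  sorted-↭⇒≡ xs-sorted ys-sorted
    (↭-trans (↭-sym (ValidForest.labels↭ (forests-sound k d c xs-sorted ts∈xs)))
             (ValidForest.labels↭ (forests-sound k d c ys-sorted ts∈ys)))

forests-unique : ∀ k d c {xs} → AllPairs _<_ xs → Unique (forests k d c xs)
forests-unique k d c {[]} _ = emptyForests-unique c
forests-unique zero d c {_ ∷ _} _ = []
forests-unique (suc k) d c {x ∷ rest} (_ ∷ rest-sorted) =
  Unique-concatMap⁺ (forestsHeadedBy k d c x) (splits-unique (AllPairs.map ℕₚ.<⇒≢ rest-sorted))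
                    headed-unique headed-disjoint
  where
  children siblings : List ℕ → List (List LTree)
  children = forests k (suc d) (childCond (isEven d))
  siblings = forests k d (tailCond c)
  node-∷-injective : ∀ {f f′ g g′} → node x f ∷ g ≡ node x f′ ∷ g′ → f ≡ f′ × g ≡ g′
  node-∷-injective refl = refl , refl
  headed-unique : ∀ {uv} → uv ∈ splits rest → Unique (forestsHeadedBy k d c x uv)
  headed-unique {u , v} uv∈ = Unique.cartesianProductWith⁺ (λ f g → node x f ∷ g) node-∷-injective
    (forests-unique k (suc d) (childCond (isEven d)) (proj₁ (splits-AllPairs rest-sorted uv∈)))
    (forests-unique k d (tailCond c) (proj₂ (splits-AllPairs rest-sorted uv∈)))
  headed-disjoint : ∀ {uv uv′ ts} → uv ∈ splits rest → uv′ ∈ splits rest →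
                    ts ∈ forestsHeadedBy k d c x uv → ts ∈ forestsHeadedBy k d c x uv′ → uv ≡ uv′
  headed-disjoint {u , v} {u′ , v′} uv∈ uv′∈ ts∈ ts∈′
    with f , g , f∈ , g∈ , refl ← ∈-cartesianProductWith⁻ (λ f g → node x f ∷ g) (children u) (siblings v) ts∈
    with _ , _ , f∈′ , g∈′ , refl ← ∈-cartesianProductWith⁻ (λ f g → node x f ∷ g) (children u′) (siblings v′) ts∈′
    with u-sorted , v-sorted ← splits-AllPairs rest-sorted uv∈
    with u′-sorted , v′-sorted ← splits-AllPairs rest-sorted uv′∈
    = cong₂ _,_ (forests-labels-unique k (suc d) (childCond (isEven d)) u-sorted u′-sorted f∈ f∈′)
                (forests-labels-unique k d (tailCond c) v-sorted v′-sorted g∈ g∈′)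

-- Counting forests

-- The Boolean records whether the roots lie on an even level.
forestCount : ℕ → Bool → LengthCond → ℕ → ℤ
forestCount k b c zero = + length (emptyForests c)
forestCount zero b c (suc m) = + 0
forestCount (suc k) b c (suc m) = (forestCount k (not b) (childCond b) ⋆ forestCount k b (tailCond c)) m

isEven-suc : ∀ n → isEven (suc n) ≡ not (isEven n)
isEven-suc zero = refl
isEven-suc (suc zero) = refl
isEven-suc (suc (suc n)) = isEven-suc n

length-cartesianProductWith : ∀ {A B C : Set} (f : A → B → C) xs ys →
                              length (cartesianProductWith f xs ys) ≡ length xs ℕ.* length ys
length-cartesianProductWith f [] ys = refl
length-cartesianProductWith f (x ∷ xs) ys =
  trans (List.length-++ (map (f x) ys))
        (cong₂ ℕ._+_ (List.length-map (f x) ys) (length-cartesianProductWith f xs ys))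

length-forests : ∀ k d c xs → + length (forests k d c xs) ≡ forestCount k (isEven d) c (length xs)
length-forests k d c [] = refl
length-forests zero d c (_ ∷ _) = refl
length-forests (suc k) d c (x ∷ rest) = splits-count (forestsHeadedBy k d c x) _ _ length-headed rest
  where
  count₁ : Bool → ℕ → ℤ
  count₁ b = forestCount k b (childCond (isEven d))
  count₂ : ℕ → ℤ
  count₂ = forestCount k (isEven d) (tailCond c)
  length-headed : ∀ u v → + length (forestsHeadedBy k d c x (u , v)) ≡
                  count₁ (not (isEven d)) (length u) * count₂ (length v)
  length-headed u v = begin
    + length (cartesianProductWith (λ f g → node x f ∷ g) F G)
      ≡⟨ cong +_ (length-cartesianProductWith (λ f g → node x f ∷ g) F G) ⟩
    + (length F ℕ.* length G)
      ≡⟨ ℤ.pos-* (length F) (length G) ⟩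
    + length F * + length G
      ≡⟨ cong₂ _*_ (length-forests k (suc d) _ u) (length-forests k d _ v) ⟩
    count₁ (isEven (suc d)) (length u) * count₂ (length v)
      ≡⟨ cong (λ b → count₁ b (length u) * count₂ (length v)) (isEven-suc d) ⟩
    count₁ (not (isEven d)) (length u) * count₂ (length v)
      ∎
    where
    open ≡-Reasoning
    F G : List (List LTree)
    F = forests k (suc d) (childCond (isEven d)) u
    G = forests k d (tailCond c) v

forestCount-fuel : ∀ {k k′} b c m → m ≤ k → m ≤ k′ → forestCount k b c m ≡ forestCount k′ b c m
forestCount-fuel b c zero _ _ = refl
forestCount-fuel {suc k} {suc k′} b c (suc m) (s≤s m≤k) (s≤s m≤k′) =
  ⋆-cong m (λ j≤m → forestCount-fuel (not b) (childCond b) _ (ℕₚ.≤-trans j≤m m≤k) (ℕₚ.≤-trans j≤m m≤k′))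
           (λ j≤m → forestCount-fuel b (tailCond c) _ (ℕₚ.≤-trans j≤m m≤k) (ℕₚ.≤-trans j≤m m≤k′))

numForests : Bool → LengthCond → ℕ → ℤ
numForests b c m = forestCount m b c m

numForests-suc : ∀ b c m →
                 numForests b c (suc m) ≡ (numForests (not b) (childCond b) ⋆ numForests b (tailCond c)) m
numForests-suc b c m =
  ⋆-cong m (λ j≤m → forestCount-fuel (not b) (childCond b) _ j≤m ℕₚ.≤-refl)
           (λ j≤m → forestCount-fuel b (tailCond c) _ j≤m ℕₚ.≤-refl)

sec tan : ℕ → ℤ
sec = numForests false evenLength
tan = numForests false oddLength

numForests-even-level : numForests true anyLength ≗ sec
numForests-even-level zero = refl
numForests-even-level (suc m) = begin
  numForests true anyLength (suc m)   ≡⟨ numForests-suc true anyLength m ⟩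
  (tan ⋆ numForests true anyLength) m ≡⟨ ⋆-comm tan (numForests true anyLength) m ⟩
  (numForests true anyLength ⋆ tan) m ≡⟨ numForests-suc false evenLength m ⟨
  sec (suc m)                         ∎
  where open ≡-Reasoning

∂sec : ∂ sec ≗ sec ⋆ tan
∂sec m = trans (numForests-suc false evenLength m) (⋆-cong m (≗⇒≗[] numForests-even-level) (λ _ → refl))

∂tan : ∂ tan ≗ sec ⋆ sec
∂tan m = trans (numForests-suc false oddLength m) (⋆-cong m (≗⇒≗[] numForests-even-level) (λ _ → refl))

numForests-odd-level : numForests false anyLength ≗ sec ⊕ tan
numForests-odd-level = strong-induction _ refl λ m ih → begin
  numForests false anyLength (suc m)
    ≡⟨ numForests-suc false anyLength m ⟩
  (numForests true anyLength ⋆ numForests false anyLength) m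
    ≡⟨ ⋆-cong m (≗⇒≗[] numForests-even-level) ih ⟩
  (sec ⋆ (sec ⊕ tan)) m
    ≡⟨ ⋆-distribˡ-⊕ sec sec tan m ⟩
  (sec ⋆ sec) m + (sec ⋆ tan) m
    ≡⟨ cong₂ _+_ (∂tan m) (∂sec m) ⟨
  tan (suc m) + sec (suc m)
    ≡⟨ ℤ.+-comm (tan (suc m)) (sec (suc m)) ⟩
  sec (suc m) + tan (suc m)
    ∎
  where open ≡-Reasoning

numForests≡euler : numForests false anyLength ≗ euler
numForests≡euler m =
  trans (numForests-odd-level m) (euler-unique (sec ⊕ tan) (SecTan.sec+tan⋆cos sec tan refl refl ∂sec ∂tan) m)

eeFreeTrees : ℕ → List LTree
eeFreeTrees n = map (node 0) (forests n 1 anyLength (applyUpTo suc n))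

applyUpTo-suc-sorted : ∀ n → AllPairs _<_ (applyUpTo suc n)
applyUpTo-suc-sorted n = AllPairs.applyUpTo⁺₁ suc n (λ i<j _ → s≤s i<j)

applyUpTo-suc-positive : ∀ n → All (0 <_) (applyUpTo suc n)
applyUpTo-suc-positive n = All.applyUpTo⁺₁ suc n (λ _ → s≤s z≤n)

eeFreeTree⇒validForest : ∀ n l ts → IsIncTree n (node l ts) → eeStar (node l ts) ≡ 0 →
                         l ≡ 0 × ValidForest 1 anyLength (applyUpTo suc n) ts
eeFreeTree⇒validForest n l ts ((l<ts , asc , inc) , labels↭) ee≡0
  with refl , ts↭ ← ↭-∷-least⁻ (labelsF-above ts l<ts inc) (applyUpTo-suc-positive n) labels↭ =
  refl , record { labels↭ = ts↭ ; increasing = inc ; ascending = asc ; ee≡0 = ee≡0 ; satisfies = tt }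

validForest⇒eeFreeTree : ∀ n ts → ValidForest 1 anyLength (applyUpTo suc n) ts →
                         IsIncTree n (node 0 ts) × eeStar (node 0 ts) ≡ 0
validForest⇒eeFreeTree n ts V = ((0<ts , ascending , increasing) , prep 0 labels↭) , ee≡0
  where
  open ValidForest V
  0<ts : All (λ t → 0 < label t) ts
  0<ts = All-labelsF⇒All-label ts (All-resp-↭ (↭-sym labels↭) (applyUpTo-suc-positive n))

∈-eeFreeTrees⇔ : ∀ n T → T ∈ eeFreeTrees n ⇔ (IsIncTree n T × eeStar T ≡ 0)
∈-eeFreeTrees⇔ n T = mk⇔ (to T) (from T)
  where
  to : ∀ T → T ∈ eeFreeTrees n → IsIncTree n T × eeStar T ≡ 0
  to T T∈ with ts , ts∈ , refl ← ∈-map⁻ (node 0) T∈ =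
    validForest⇒eeFreeTree n ts (forests-sound n 1 anyLength (applyUpTo-suc-sorted n) ts∈)
  from : ∀ T → IsIncTree n T × eeStar T ≡ 0 → T ∈ eeFreeTrees n
  from (node l ts) (inc , ee≡0) with refl , V ← eeFreeTree⇒validForest n l ts inc ee≡0 =
    ∈-map⁺ (node 0) (forests-complete n 1 anyLength (applyUpTo-suc-sorted n)
                                      (ℕₚ.≤-reflexive (List.length-applyUpTo suc n)) V)

eeFreeTrees-unique : ∀ n → Unique (eeFreeTrees n)
eeFreeTrees-unique n = Unique.map⁺ node-injective (forests-unique n 1 anyLength (applyUpTo-suc-sorted n))
  where
  node-injective : ∀ {ts ts′} → node 0 ts ≡ node 0 ts′ → ts ≡ ts′
  node-injective refl = refl

length-eeFreeTrees : ∀ n → + length (eeFreeTrees n) ≡ euler n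
length-eeFreeTrees n = begin
  + length (map (node 0) (forests n 1 anyLength (applyUpTo suc n)))
    ≡⟨ cong +_ (List.length-map (node 0) (forests n 1 anyLength (applyUpTo suc n))) ⟩
  + length (forests n 1 anyLength (applyUpTo suc n))
    ≡⟨ length-forests n 1 anyLength (applyUpTo suc n) ⟩
  forestCount n false anyLength (length (applyUpTo suc n))
    ≡⟨ cong (forestCount n false anyLength) (List.length-applyUpTo suc n) ⟩
  numForests false anyLength n
    ≡⟨ numForests≡euler n ⟩
  euler n
    ∎
  where open ≡-Reasoning

corollary2p5 : (n : ℕ) →
    Σ (List LTree) (λ L →
      Unique L × ((T : LTree) → (T ∈ L) ⇔ (IsIncTree n T × eeStar T ≡ 0)) × (+ length L ≡ euler n))
corollary2p5 n = eeFreeTrees n , eeFreeTrees-unique n , ∈-eeFreeTrees⇔ n , length-eeFreeTrees n
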